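{- Let $F$ be a graph polynomial with values in $\mathbb{Z}[x]$, let $(H_i)_{i\in\mathbb{N}}$ be a sequence of pairwise non-isomorphic graphs, and let $f:\mathbb{N}\to\mathbb{N}$ be an unbounded function such that for every $k\in\mathbb{N}$ and all $i,j$: $F(H_i\bowtie H_j;k)=0$ if and only if $i+j>f(k)$. Then the connection matrix $\mathcal{H}(\bowtie,F)$ has infinite rank. The same holds when the join $\bowtie$ is replaced everywhere (in the hypothesis and in the matrix) by the disjoint union $\sqcup$.
   Context: All graphs are finite simple graphs. $G_1\sqcup G_2$ is the disjoint union and $G_1\bowtie G_2$ the join (disjoint union plus all edges between $V(G_1)$ and $V(G_2)$). Let $(G_i)$ enumerate all finite graphs up to isomorphism. The connection (Hankel) matrix $\mathcal{H}(\bowtie,F)$ is the infinite matrix with rows and columns indexed by the $G_i$ and entry $F(G_i\bowtie G_j;x)$ at $(G_i,G_j)$; $\mathcal{H}(\sqcup,F)$ is defined analogously with $\sqcup$. The rank of an infinite matrix over $\mathbb{Z}[x]$ is the supremum of ranks of its finite submatrices (over the fraction field of $\mathbb{Z}[x]$). -}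

module Defs where

open import Data.Nat as ℕ using (ℕ; zero; suc)
open import Data.Integer as ℤ using (ℤ; +_)
open import Data.Fin using (Fin; zero; suc; splitAt; punchIn; toℕ)
open import Data.Bool using (Bool; true; false)
open import Data.Sum using (_⊎_; inj₁; inj₂)
open import Data.List using (List; []; _∷_; map; foldr)
open import Data.Product using (Σ; ∃; _×_; _,_)
open import Relation.Binary.PropositionalEquality using (_≡_; _≢_; refl)
open import Relation.Nullary using (¬_)
open import Function.Bundles using (_⤖_; Bijection)

record Graph : Set where
  field
    n      : ℕ
    adj    : Fin n → Fin n → Bool
    adjSym : ∀ u v → adj u v ≡ adj v u
    irrefl : ∀ u → adj u u ≡ false
open Graph public

_≅_ : Graph → Graph → Set
G ≅ H = Σ (Fin (n G) ⤖ Fin (n H)) λ σ →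
          ∀ u v → adj H (Bijection.to σ u) (Bijection.to σ v) ≡ adj G u v

combAdj : (b : Bool) (G H : Graph) →
          Fin (n G ℕ.+ n H) → Fin (n G ℕ.+ n H) → Bool
combAdj b G H u v with splitAt (n G) u | splitAt (n G) v
... | inj₁ a | inj₁ c = adj G a c
... | inj₂ a | inj₂ c = adj H a c
... | inj₁ _ | inj₂ _ = b
... | inj₂ _ | inj₁ _ = b

combSym : ∀ b G H u v → combAdj b G H u v ≡ combAdj b G H v u
combSym b G H u v with splitAt (n G) u | splitAt (n G) v
... | inj₁ a | inj₁ c = adjSym G a c
... | inj₂ a | inj₂ c = adjSym H a c
... | inj₁ _ | inj₂ _ = refl
... | inj₂ _ | inj₁ _ = refl

combIrr : ∀ b G H u → combAdj b G H u u ≡ false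
combIrr b G H u with splitAt (n G) u
... | inj₁ a = irrefl G a
... | inj₂ a = irrefl H a

combine : Bool → Graph → Graph → Graph
combine b G H = record
  { n = n G ℕ.+ n H ; adj = combAdj b G H
  ; adjSym = combSym b G H ; irrefl = combIrr b G H }

_⊔_ : Graph → Graph → Graph
_⊔_ = combine false

_⋈_ : Graph → Graph → Graph
_⋈_ = combine true

-- Polynomials in ℤ[x] as coefficient lists (constant term first)

Poly : Set
Poly = List ℤ

coeff : Poly → ℕ → ℤ
coeff []      _       = + 0
coeff (a ∷ _) zero    = a
coeff (_ ∷ p) (suc i) = coeff p i

-- equality in ℤ[x] (ignores trailing zeros)
_≈ₚ_ : Poly → Poly → Set
p ≈ₚ q = ∀ i → coeff p i ≡ coeff q i

NonZeroPoly : Poly → Set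
NonZeroPoly p = ∃ λ i → coeff p i ≢ + 0

_+ₚ_ : Poly → Poly → Poly
[]      +ₚ q       = q
(a ∷ p) +ₚ []      = a ∷ p
(a ∷ p) +ₚ (b ∷ q) = (a ℤ.+ b) ∷ (p +ₚ q)

-ₚ_ : Poly → Poly
-ₚ p = map ℤ.-_ p

_*ₚ_ : Poly → Poly → Poly
[]      *ₚ q = []
(a ∷ p) *ₚ q = map (a ℤ.*_) q +ₚ (+ 0 ∷ (p *ₚ q))

oneₚ : Poly
oneₚ = + 1 ∷ []

eval : Poly → ℤ → ℤ
eval p x = foldr (λ a acc → a ℤ.+ x ℤ.* acc) (+ 0) p

signₚ : ℕ → Poly → Poly
signₚ zero    p = p
signₚ (suc k) p = -ₚ (signₚ k p)

sumFin : ∀ m → (Fin m → Poly) → Poly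
sumFin zero    f = []
sumFin (suc m) f = f zero +ₚ sumFin m (λ j → f (suc j))

det : ∀ m → (Fin m → Fin m → Poly) → Poly
det zero    M = oneₚ
det (suc m) M = sumFin (suc m) λ j →
  signₚ (toℕ j) (M zero j *ₚ det m (λ a b → M (suc a) (punchIn j b)))

IsGraphPolynomial : (Graph → Poly) → Set
IsGraphPolynomial F = ∀ G H → G ≅ H → F G ≈ₚ F H

PairwiseNonIso : ∀ {I : Set} → (I → Graph) → Set
PairwiseNonIso {I} H = ∀ i j → i ≢ j → ¬ (H i ≅ H j)

-- The connection matrix H(op, F) (rows/columns indexed by graphs up to
-- isomorphism, entry F(G op G')) has rank ≥ r over Frac(ℤ[x]):
-- some r×r submatrix (r pairwise non-isomorphic row graphs and r pairwise
-- non-isomorphic column graphs) has nonzero determinant.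
RankAtLeast : (Graph → Graph → Graph) → (Graph → Poly) → ℕ → Set
RankAtLeast op F r =
  Σ (Fin r → Graph) λ R → Σ (Fin r → Graph) λ C →
    PairwiseNonIso R × PairwiseNonIso C ×
    NonZeroPoly (det r (λ a b → F (op (R a) (C b))))

InfiniteRank : (Graph → Graph → Graph) → (Graph → Poly) → Set
InfiniteRank op F = ∀ r → RankAtLeast op F r

{-# OPTIONS --safe #-}
-- Given r, pick k with f k ≥ r and take rows H (f k ∸ a), columns H b for a, b < r.
-- As (f k ∸ a) + b > f k exactly when a < b, evaluating this submatrix at x = k gives a
-- lower triangular integer matrix with nonzero diagonal, so its determinant is nonzero
-- at k and hence nonzero in ℤ[x]. Nothing about ⋈ or ⊔ beyond this pattern is used.
module Submission where

open import Defs
open import Data.Nat using (ℕ; _+_; _>_; _≤_)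
open import Data.Integer using (+_)
open import Data.Product using (_×_; ∃)
open import Relation.Binary.PropositionalEquality using (_≡_)
open import Function.Bundles using (_⇔_)

open import Data.Nat as ℕ using (zero; suc; _∸_; s≤s; z≤n)
import Data.Nat.Properties as ℕ
open import Data.Integer as ℤ using (0ℤ; 1ℤ)
import Data.Integer.Properties as ℤ
open import Data.Integer.Tactic.RingSolver using (solve-∀)
open import Data.Fin as Fin using (Fin; toℕ)
open import Data.Fin.Properties using (toℕ-injective; toℕ<n)
open import Data.List using ([]; _∷_; map)
open import Data.Product using (_,_)
open import Data.Sum using ([_,_]′)
open import Function using (_∘_)
open import Function.Bundles using (module Equivalence)
open import Function.Definitions using (Injective)
open import Relation.Binary.PropositionalEquality
  using (refl; sym; trans; subst; cong; cong₂; _≢_; module ≡-Reasoning)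
open import Relation.Nullary using (yes; no; contradiction)

eval-+ₚ : ∀ p q x → eval (p +ₚ q) x ≡ eval p x ℤ.+ eval q x
eval-+ₚ []      q       x = sym (ℤ.+-identityˡ _)
eval-+ₚ (a ∷ p) []      x = sym (ℤ.+-identityʳ _)
eval-+ₚ (a ∷ p) (b ∷ q) x =
  trans (cong (λ t → (a ℤ.+ b) ℤ.+ x ℤ.* t) (eval-+ₚ p q x))
        (interchange a b x (eval p x) (eval q x))
  where
  interchange : ∀ a b x P Q → (a ℤ.+ b) ℤ.+ x ℤ.* (P ℤ.+ Q) ≡ (a ℤ.+ x ℤ.* P) ℤ.+ (b ℤ.+ x ℤ.* Q)
  interchange = solve-∀

eval-map-* : ∀ a q x → eval (map (a ℤ.*_) q) x ≡ a ℤ.* eval q x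
eval-map-* a []      x = sym (ℤ.*-zeroʳ a)
eval-map-* a (b ∷ q) x =
  trans (cong (λ t → a ℤ.* b ℤ.+ x ℤ.* t) (eval-map-* a q x))
        (factor a b x (eval q x))
  where
  factor : ∀ a b x Q → a ℤ.* b ℤ.+ x ℤ.* (a ℤ.* Q) ≡ a ℤ.* (b ℤ.+ x ℤ.* Q)
  factor = solve-∀

eval-*ₚ : ∀ p q x → eval (p *ₚ q) x ≡ eval p x ℤ.* eval q x
eval-*ₚ []      q x = refl
eval-*ₚ (a ∷ p) q x = begin
  eval (map (a ℤ.*_) q +ₚ (0ℤ ∷ (p *ₚ q))) x
    ≡⟨ eval-+ₚ (map (a ℤ.*_) q) (0ℤ ∷ (p *ₚ q)) x ⟩
  eval (map (a ℤ.*_) q) x ℤ.+ (0ℤ ℤ.+ x ℤ.* eval (p *ₚ q) x)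
    ≡⟨ cong₂ (λ s t → s ℤ.+ (0ℤ ℤ.+ x ℤ.* t)) (eval-map-* a q x) (eval-*ₚ p q x) ⟩
  a ℤ.* eval q x ℤ.+ (0ℤ ℤ.+ x ℤ.* (eval p x ℤ.* eval q x))
    ≡⟨ factor a x (eval p x) (eval q x) ⟩
  (a ℤ.+ x ℤ.* eval p x) ℤ.* eval q x ∎
  where
  open ≡-Reasoning
  factor : ∀ a x P Q → a ℤ.* Q ℤ.+ (0ℤ ℤ.+ x ℤ.* (P ℤ.* Q)) ≡ (a ℤ.+ x ℤ.* P) ℤ.* Q
  factor = solve-∀

eval--ₚ : ∀ p x → eval (-ₚ p) x ≡ ℤ.- eval p x
eval--ₚ []      x = refl
eval--ₚ (a ∷ p) x =
  trans (cong (λ t → ℤ.- a ℤ.+ x ℤ.* t) (eval--ₚ p x)) (neg-distrib a x (eval p x))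
  where
  neg-distrib : ∀ a x P → ℤ.- a ℤ.+ x ℤ.* (ℤ.- P) ≡ ℤ.- (a ℤ.+ x ℤ.* P)
  neg-distrib = solve-∀

eval-oneₚ : ∀ x → eval oneₚ x ≡ 1ℤ
eval-oneₚ x = trans (cong (λ t → 1ℤ ℤ.+ t) (ℤ.*-zeroʳ x)) (ℤ.+-identityʳ 1ℤ)

eval-signₚ-root : ∀ k p x → eval p x ≡ 0ℤ → eval (signₚ k p) x ≡ 0ℤ
eval-signₚ-root zero    p x p[x]≡0 = p[x]≡0
eval-signₚ-root (suc k) p x p[x]≡0 =
  trans (eval--ₚ (signₚ k p) x) (cong ℤ.-_ (eval-signₚ-root k p x p[x]≡0))

eval-sumFin-root : ∀ m (f : Fin m → Poly) x →
                   (∀ j → eval (f j) x ≡ 0ℤ) → eval (sumFin m f) x ≡ 0ℤ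
eval-sumFin-root zero    f x roots = refl
eval-sumFin-root (suc m) f x roots =
  trans (eval-+ₚ (f Fin.zero) (sumFin m (f ∘ Fin.suc)) x)
        (cong₂ ℤ._+_ (roots Fin.zero) (eval-sumFin-root m (f ∘ Fin.suc) x (roots ∘ Fin.suc)))

eval-0∷ : ∀ p x → eval (0ℤ ∷ p) x ≡ x ℤ.* eval p x
eval-0∷ p x = ℤ.+-identityˡ _

eval≢0⇒NonZeroPoly : ∀ p x → eval p x ≢ 0ℤ → NonZeroPoly p
eval≢0⇒NonZeroPoly []      x p[x]≢0 = contradiction refl p[x]≢0
eval≢0⇒NonZeroPoly (a ∷ p) x p[x]≢0 with a ℤ.≟ 0ℤ
... | no a≢0  = 0 , a≢0
... | yes refl with eval≢0⇒NonZeroPoly p x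
                      (p[x]≢0 ∘ λ e → trans (eval-0∷ p x) (trans (cong (x ℤ.*_) e) (ℤ.*-zeroʳ x)))
...   | i , pᵢ≢0 = suc i , pᵢ≢0

minor₀₀ : ∀ {m} → (Fin (suc m) → Fin (suc m) → Poly) → Fin m → Fin m → Poly
minor₀₀ M a b = M (Fin.suc a) (Fin.suc b)

eval-det-firstRowRoot : ∀ m (M : Fin (suc m) → Fin (suc m) → Poly) x →
  (∀ j → eval (M Fin.zero (Fin.suc j)) x ≡ 0ℤ) →
  eval (det (suc m) M) x ≡ eval (M Fin.zero Fin.zero) x ℤ.* eval (det m (minor₀₀ M)) x
eval-det-firstRowRoot m M x firstRow = begin
  eval (M₀₀·minor +ₚ sumFin m expansionTerm) x
    ≡⟨ eval-+ₚ M₀₀·minor (sumFin m expansionTerm) x ⟩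
  eval M₀₀·minor x ℤ.+ eval (sumFin m expansionTerm) x
    ≡⟨ cong (λ t → eval M₀₀·minor x ℤ.+ t) (eval-sumFin-root m expansionTerm x expansionTerm-root) ⟩
  eval M₀₀·minor x ℤ.+ 0ℤ
    ≡⟨ ℤ.+-identityʳ _ ⟩
  eval M₀₀·minor x
    ≡⟨ eval-*ₚ (M Fin.zero Fin.zero) (det m (minor₀₀ M)) x ⟩
  eval (M Fin.zero Fin.zero) x ℤ.* eval (det m (minor₀₀ M)) x ∎
  where
  open ≡-Reasoning
  M₀₀·minor : Poly
  M₀₀·minor = M Fin.zero Fin.zero *ₚ det m (minor₀₀ M)
  expansionTerm : Fin m → Poly
  expansionTerm j = signₚ (toℕ (Fin.suc j))
    (M Fin.zero (Fin.suc j) *ₚ det m (λ a b → M (Fin.suc a) (Fin.punchIn (Fin.suc j) b)))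
  expansionTerm-root : ∀ j → eval (expansionTerm j) x ≡ 0ℤ
  expansionTerm-root j = eval-signₚ-root (toℕ (Fin.suc j)) _ x (begin
    eval (M Fin.zero (Fin.suc j) *ₚ D) x    ≡⟨ eval-*ₚ (M Fin.zero (Fin.suc j)) D x ⟩
    eval (M Fin.zero (Fin.suc j)) x ℤ.* eval D x ≡⟨ cong (ℤ._* eval D x) (firstRow j) ⟩
    0ℤ ℤ.* eval D x                        ≡⟨ ℤ.*-zeroˡ (eval D x) ⟩
    0ℤ                                     ∎)
    where D = det m (λ a b → M (Fin.suc a) (Fin.punchIn (Fin.suc j) b))

eval-det-lowerTriangular≢0 : ∀ m (M : Fin m → Fin m → Poly) x →
  (∀ a b → a Fin.< b → eval (M a b) x ≡ 0ℤ) →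
  (∀ a → eval (M a a) x ≢ 0ℤ) →
  eval (det m M) x ≢ 0ℤ
eval-det-lowerTriangular≢0 zero    M x above diag det≡0 =
  contradiction (trans (sym (eval-oneₚ x)) det≡0) λ ()
eval-det-lowerTriangular≢0 (suc m) M x above diag det≡0 =
  [ diag Fin.zero , minor≢0 ]′ (ℤ.i*j≡0⇒i≡0∨j≡0 _ product≡0)
  where
  product≡0 : eval (M Fin.zero Fin.zero) x ℤ.* eval (det m (minor₀₀ M)) x ≡ 0ℤ
  product≡0 = trans (sym (eval-det-firstRowRoot m M x (λ j → above Fin.zero (Fin.suc j) (s≤s z≤n)))) det≡0
  minor≢0 : eval (det m (minor₀₀ M)) x ≢ 0ℤ
  minor≢0 = eval-det-lowerTriangular≢0 m (minor₀₀ M) x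
              (λ a b a<b → above (Fin.suc a) (Fin.suc b) (s≤s a<b)) (diag ∘ Fin.suc)

n<n∸m+o : ∀ {m n o} → m ≤ n → m ℕ.< o → n ℕ.< n ∸ m + o
n<n∸m+o {m} {n} m≤n m<o =
  subst (ℕ._< n ∸ m + _) (ℕ.m∸n+n≡m m≤n) (ℕ.+-monoʳ-< (n ∸ m) m<o)

PairwiseNonIso-∘ : ∀ {I J : Set} {H : I → Graph} {g : J → I} →
                   PairwiseNonIso H → Injective _≡_ _≡_ g → PairwiseNonIso (H ∘ g)
PairwiseNonIso-∘ H-nonIso g-injective a b a≢b = H-nonIso _ _ (a≢b ∘ g-injective)

Unbounded : (ℕ → ℕ) → Set
Unbounded f = ∀ m → ∃ λ k → m ≤ f k

VanishesExactlyBeyond : (Graph → Graph → Graph) → (Graph → Poly) → (ℕ → Graph) → (ℕ → ℕ) → Set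
VanishesExactlyBeyond op F H f =
  ∀ k i j → (eval (F (op (H i) (H j))) (+ k) ≡ + 0) ⇔ (i + j > f k)

infiniteRank : ∀ op F (H : ℕ → Graph) → PairwiseNonIso H → ∀ f → Unbounded f →
               VanishesExactlyBeyond op F H f → InfiniteRank op F
infiniteRank op F H H-nonIso f f-unbounded vanishes r with f-unbounded r
... | k , r≤fk =
  H ∘ reflect , H ∘ toℕ ,
  PairwiseNonIso-∘ {H = H} H-nonIso reflect-injective , PairwiseNonIso-∘ {H = H} H-nonIso toℕ-injective ,
  eval≢0⇒NonZeroPoly (det r M) (+ k) (eval-det-lowerTriangular≢0 r M (+ k) above-diagonal on-diagonal)
  where
  reflect : Fin r → ℕ
  reflect a = f k ∸ toℕ a
  M : Fin r → Fin r → Poly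
  M a b = F (op (H (reflect a)) (H (toℕ b)))
  toℕ≤fk : ∀ a → toℕ a ≤ f k
  toℕ≤fk a = ℕ.≤-trans (ℕ.<⇒≤ (toℕ<n a)) r≤fk
  reflect-injective : Injective _≡_ _≡_ reflect
  reflect-injective {a} {b} = toℕ-injective ∘ ℕ.∸-cancelˡ-≡ (toℕ≤fk a) (toℕ≤fk b)
  above-diagonal : ∀ a b → a Fin.< b → eval (M a b) (+ k) ≡ 0ℤ
  above-diagonal a b a<b =
    Equivalence.from (vanishes k (reflect a) (toℕ b)) (n<n∸m+o (toℕ≤fk a) a<b)
  on-diagonal : ∀ a → eval (M a a) (+ k) ≢ 0ℤ
  on-diagonal a =
    ℕ.<-irrefl (sym (ℕ.m∸n+n≡m (toℕ≤fk a))) ∘ Equivalence.to (vanishes k (reflect a) (toℕ a))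

lemma3 :
    ((F : Graph → Poly) → IsGraphPolynomial F →
     (H : ℕ → Graph) → PairwiseNonIso H →
     (f : ℕ → ℕ) → (∀ m → ∃ λ k → m ≤ f k) →
     (∀ k i j → (eval (F (H i ⋈ H j)) (+ k) ≡ + 0) ⇔ (i + j > f k)) →
     InfiniteRank _⋈_ F)
    ×
    ((F : Graph → Poly) → IsGraphPolynomial F →
     (H : ℕ → Graph) → PairwiseNonIso H →
     (f : ℕ → ℕ) → (∀ m → ∃ λ k → m ≤ f k) →
     (∀ k i j → (eval (F (H i ⊔ H j)) (+ k) ≡ + 0) ⇔ (i + j > f k)) →
     InfiniteRank _⊔_ F)
lemma3 = (λ F _ → infiniteRank _⋈_ F) , (λ F _ → infiniteRank _⊔_ F)
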